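{- Let $T$ be a string, let $F_1,F_2,\dots$ be its greedy LZSE factorization, and let $k\ge1$ with $T[1,p]=F_1\cdots F_k$. Define extended factors recursively: for $1\le i<k$, $E_i=F_iF_{i+1}$ if $F_i\in\{E_1,\dots,E_{i-1}\}$ and $E_i=F_i$ otherwise; and $E_k=F_k$, which is included only if $F_k\notin\{E_1,\dots,E_{k-1}\}$. Let $\mathcal{E}$ be the multiset of the (included) extended factors. Then every element of $\mathcal{E}$ appears at most twice in $\mathcal{E}$.
   Context: An LZSE factorization of $T$ is a sequence of non-empty strings $F_1,\dots,F_f$ with $T=F_1\cdots F_f$, each either a char factor (a single character at its first occurrence in $T$) or a copy factor $F_i=F_l\cdots F_r$ for some $1\le l\le r<i$. The greedy LZSE factorization scans $T$ left to right, at each step taking a char factor if the next character is new, and otherwise the longest prefix of the remaining suffix equal to a concatenation $F_l\cdots F_r$ of consecutive already chosen factors. -}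

module Defs where

open import Data.Nat using (ℕ; _≤_)
open import Data.List using (List; []; _∷_; _++_; concat; length; filter)
open import Data.List.Properties using (≡-dec)
open import Data.List.Membership.Propositional using (_∈_; _∉_)
open import Data.Product using (Σ; _×_; ∃; ∃-syntax)
open import Data.Sum using (_⊎_)
open import Data.Unit using (⊤)
open import Relation.Binary.Definitions using (DecidableEquality)
open import Relation.Binary.PropositionalEquality using (_≡_; _≢_)
open import Relation.Nullary using (does)
open import Data.Bool using (if_then_else_)
open import Data.List.Relation.Unary.Any using (any?)

module _ {A : Set} where

  IsPrefixOf : List A → List A → Set
  IsPrefixOf g S = ∃[ t ] (g ++ t ≡ S)

  IsCopyOf : List (List A) → List A → Set
  IsCopyOf prev g =
    ∃[ as ] ∃[ bs ] ∃[ cs ] (prev ≡ as ++ bs ++ cs × bs ≢ [] × g ≡ concat bs)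

  CharStep : List (List A) → List A → Set
  CharStep prev f = ∃[ c ] (f ≡ c ∷ [] × c ∉ concat prev)

  GreedyCopyStep : List (List A) → List A → List A → Set
  GreedyCopyStep prev f S =
    IsCopyOf prev f ×
    (∀ g → IsCopyOf prev g → IsPrefixOf g S → length g ≤ length f)

  GreedyFrom : List (List A) → List (List A) → Set
  GreedyFrom prev [] = ⊤
  GreedyFrom prev (f ∷ rest) =
    (f ≢ [] × (CharStep prev f ⊎ GreedyCopyStep prev f (concat (f ∷ rest))))
    × GreedyFrom (prev ++ f ∷ []) rest

  IsGreedyLZSE : List A → List (List A) → Set
  IsGreedyLZSE T fs = concat fs ≡ T × GreedyFrom [] fs

module _ {A : Set} (_≟_ : DecidableEquality A) where

  _≟s_ : DecidableEquality (List A)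
  _≟s_ = ≡-dec _≟_

  memb : List A → List (List A) → _
  memb f acc = does (any? (f ≟s_) acc)

  -- extGo acc [F_i,…,F_k] with acc = [E_1,…,E_{i-1}] returns the included
  -- extended factors E_i,…,E_k.
  extGo : List (List A) → List (List A) → List (List A)
  extGo acc [] = []
  extGo acc (f ∷ []) = if memb f acc then [] else f ∷ []
  extGo acc (f ∷ g ∷ rest) =
    let e = if memb f acc then f ++ g else f
    in e ∷ extGo (acc ++ e ∷ []) (g ∷ rest)

  extendedFactors : List (List A) → List (List A)
  extendedFactors = extGo []

  countStr : List A → List (List A) → ℕ
  countStr e xs = length (filter (_≟s e) xs)

-- Every extended factor E_j is a concatenation of consecutive factors among
-- F_1 … F_{j+1}, and once a string is such a copy of F_1 ⋯ F_{i-1} it is never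
-- added again: not as E_i = F_i, which requires F_i to be new, and not as
-- E_i = F_i F_{i+1}, because that string is never a copy of F_1 ⋯ F_{i-1}.
-- For a copy factor F_i this is greedy maximality; a char factor F_i = c is
-- never an earlier extended factor, since c does not occur in F_1 ⋯ F_{i-1}.
-- A string first added as E_i = F_i is a copy right away; one first added as
-- E_i = F_i F_{i+1} becomes a copy after the next step, so it is added at most
-- once more.
module Submission where

open import Defs
open import Data.Nat using (ℕ; _+_; _≤_; _<_; zero; suc; z≤n; s≤s)
open import Data.Nat.Properties using (+-comm; +-identityʳ; ≤-trans; ≤-reflexive; <⇒≢; <⇒≱; m<m+n; m≤n+m)
open import Data.List using (List; length; take; []; _∷_; _++_; concat; filter)
open import Data.List.Properties using (++-assoc; ++-identityʳ; length-++; filter-++; filter-accept; filter-reject; filter-none)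
open import Data.List.Membership.Propositional using (_∈_; _∉_)
open import Data.List.Membership.Propositional.Properties using (∈-++⁻; ∈-concat⁺; ∈-concat⁻)
open import Data.List.Relation.Unary.Any using (here; any?)
open import Data.List.Relation.Unary.Any.Properties using (++⁺ˡ; ++⁺ʳ)
import Data.List.Relation.Unary.All as All
open import Data.List.Relation.Unary.All.Properties using (¬Any⇒All¬)
open import Data.Product using (_,_; proj₁; proj₂)
open import Data.Sum using (_⊎_; inj₁; inj₂; [_,_]′)
open import Data.Bool using (if_then_else_)
open import Function using (_∘_)
open import Relation.Binary.Definitions using (DecidableEquality)
open import Relation.Binary.PropositionalEquality using (_≡_; _≢_; refl; sym; trans; cong; subst; module ≡-Reasoning)
open import Relation.Nullary using (¬_; yes; no; proof; contradiction)
open import Relation.Nullary.Reflects using (Reflects; ofʸ; ofⁿ)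

module _ {B : Set} where

  length-<-++ˡ : ∀ (xs : List B) {ys} → ys ≢ [] → length xs < length (xs ++ ys)
  length-<-++ˡ xs {[]}    ys≢[] = contradiction refl ys≢[]
  length-<-++ˡ xs {_ ∷ _} _     =
    subst (length xs <_) (sym (length-++ xs)) (m<m+n (length xs) (s≤s z≤n))

  length-<-++ʳ : ∀ {xs} (ys : List B) → xs ≢ [] → length ys < length (xs ++ ys)
  length-<-++ʳ {[]}     ys xs≢[] = contradiction refl xs≢[]
  length-<-++ʳ {_ ∷ xs} ys _     =
    s≤s (subst (length ys ≤_) (sym (length-++ xs)) (m≤n+m (length ys) (length xs)))

  ∉-snoc : ∀ {e x : B} xs → x ≢ e → e ∉ xs → e ∉ xs ++ x ∷ []
  ∉-snoc xs x≢e e∉xs = [ e∉xs , (λ { (here e≡x) → x≢e (sym e≡x) }) ]′ ∘ ∈-++⁻ xs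

module _ {A : Set} where

  IsCopyOf-++ : ∀ {prev : List (List A)} {e} ys → IsCopyOf prev e → IsCopyOf (prev ++ ys) e
  IsCopyOf-++ ys (as , bs , cs , refl , bs≢[] , e≡) =
    as , bs , cs ++ ys , trans (++-assoc as (bs ++ cs) ys) (cong (as ++_) (++-assoc bs cs ys)) , bs≢[] , e≡

  IsCopyOf-last : ∀ (prev : List (List A)) f → IsCopyOf (prev ++ f ∷ []) f
  IsCopyOf-last prev f = prev , f ∷ [] , [] , refl , (λ ()) , sym (++-identityʳ f)

  IsCopyOf-last₂ : ∀ {prev p : List (List A)} {h f e} → prev ≡ p ++ h ∷ [] → e ≡ h ++ f →
                   IsCopyOf (prev ++ f ∷ []) e
  IsCopyOf-last₂ {p = p} {h} {f} refl refl =
    p , h ∷ f ∷ [] , [] , ++-assoc p (h ∷ []) (f ∷ []) , (λ ()) , cong (h ++_) (sym (++-identityʳ f))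

  IsCopyOf-⊆ : ∀ {prev : List (List A)} {g c} → IsCopyOf prev g → c ∈ g → c ∈ concat prev
  IsCopyOf-⊆ (as , bs , cs , refl , _ , refl) c∈g =
    ∈-concat⁺ (++⁺ʳ as (++⁺ˡ (∈-concat⁻ bs c∈g)))

  greedy-char-or-¬copy : ∀ {prev : List (List A)} {f g rest} → GreedyFrom prev (f ∷ g ∷ rest) →
                         CharStep prev f ⊎ ¬ IsCopyOf prev (f ++ g)
  greedy-char-or-¬copy ((_ , inj₁ char) , _) = inj₁ char
  greedy-char-or-¬copy {f = f} {g} {rest} ((_ , inj₂ (_ , longest)) , (g≢[] , _) , _) =
    inj₂ λ copy → <⇒≱ (length-<-++ˡ f g≢[]) (longest (f ++ g) copy (concat rest , ++-assoc f g (concat rest)))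

module _ {A : Set} (_≟_ : DecidableEquality A) where

  private
    _≟ₗ_ : DecidableEquality (List A)
    _≟ₗ_ = _≟s_ _≟_

  count : List A → List (List A) → ℕ
  count = countStr _≟_

  count-++ : ∀ e xs ys → count e (xs ++ ys) ≡ count e xs + count e ys
  count-++ e xs ys =
    trans (cong length (filter-++ (_≟ₗ e) xs ys)) (length-++ (filter (_≟ₗ e) xs))

  count-snoc-≡ : ∀ e xs → count e (xs ++ e ∷ []) ≡ suc (count e xs)
  count-snoc-≡ e xs = begin
    count e (xs ++ e ∷ [])          ≡⟨ count-++ e xs (e ∷ []) ⟩
    count e xs + count e (e ∷ [])   ≡⟨ cong (λ n → count e xs + length n) (filter-accept (_≟ₗ e) refl) ⟩
    count e xs + 1                  ≡⟨ +-comm (count e xs) 1 ⟩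
    suc (count e xs)                ∎
    where open ≡-Reasoning

  count-snoc-≢ : ∀ {x e} xs → x ≢ e → count e (xs ++ x ∷ []) ≡ count e xs
  count-snoc-≢ {x} {e} xs x≢e = begin
    count e (xs ++ x ∷ [])          ≡⟨ count-++ e xs (x ∷ []) ⟩
    count e xs + count e (x ∷ [])   ≡⟨ cong (λ n → count e xs + length n) (filter-reject (_≟ₗ e) x≢e) ⟩
    count e xs + 0                  ≡⟨ +-identityʳ (count e xs) ⟩
    count e xs                      ∎
    where open ≡-Reasoning

  count-∉ : ∀ {e xs} → e ∉ xs → count e xs ≡ 0
  count-∉ {e} {xs} e∉xs =
    cong length (filter-none (_≟ₗ e) (All.map (λ e≢x x≡e → e≢x (sym x≡e)) (¬Any⇒All¬ xs e∉xs)))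

  count-snoc-∉ : ∀ {e xs} → e ∉ xs → count e (xs ++ e ∷ []) ≡ 1
  count-snoc-∉ {e} {xs} e∉xs = trans (count-snoc-≡ e xs) (cong suc (count-∉ e∉xs))

  memb-reflects : ∀ f acc → Reflects (f ∈ acc) (memb _≟_ f acc)
  memb-reflects f acc = proof (any? (f ≟ₗ_) acc)

  -- Before factor i: acc = E_1 … E_{i-1}, prev = F_1 … F_{i-1}, f = F_i.
  -- A pending string is E_{i-1} = F_{i-1} F_i, a copy from the next step on.
  data Status (acc prev : List (List A)) (f e : List A) : Set where
    unseen  : e ∉ acc → Status acc prev f e
    copied  : IsCopyOf prev e → count e acc ≤ 2 → Status acc prev f e
    pending : ∀ p h → prev ≡ p ++ h ∷ [] → h ≢ [] → e ≡ h ++ f → count e acc ≤ 1 →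
              Status acc prev f e

  Invariant : List (List A) → List (List A) → List A → Set
  Invariant acc prev f = ∀ e → Status acc prev f e

  Status-count≤2 : ∀ {acc prev f e} → Status acc prev f e → count e acc ≤ 2
  Status-count≤2 (unseen e∉acc)          = ≤-trans (≤-reflexive (count-∉ e∉acc)) z≤n
  Status-count≤2 (copied _ c≤2)          = c≤2
  Status-count≤2 (pending _ _ _ _ _ c≤1) = ≤-trans c≤1 (s≤s z≤n)

  Status-snoc-≢ : ∀ {acc prev f e x} g → x ≢ e → Status acc prev f e →
                  Status (acc ++ x ∷ []) (prev ++ f ∷ []) g e
  Status-snoc-≢ {acc} _ x≢e (unseen e∉acc) = unseen (∉-snoc acc x≢e e∉acc)
  Status-snoc-≢ {acc} {f = f} _ x≢e (copied copy c≤2) =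
    copied (IsCopyOf-++ (f ∷ []) copy) (≤-trans (≤-reflexive (count-snoc-≢ acc x≢e)) c≤2)
  Status-snoc-≢ {acc} _ x≢e (pending _ _ prev≡ _ e≡ c≤1) =
    copied (IsCopyOf-last₂ prev≡ e≡) (≤-trans (≤-reflexive (count-snoc-≢ acc x≢e)) (≤-trans c≤1 (s≤s z≤n)))

  Invariant-snoc-fresh : ∀ {acc prev f} g → f ∉ acc → Invariant acc prev f →
                         Invariant (acc ++ f ∷ []) (prev ++ f ∷ []) g
  Invariant-snoc-fresh {acc} {prev} {f} g f∉acc inv e with f ≟ₗ e
  ... | no f≢e   = Status-snoc-≢ g f≢e (inv e)
  ... | yes refl = copied (IsCopyOf-last prev f) (≤-trans (≤-reflexive (count-snoc-∉ f∉acc)) (s≤s z≤n))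

  Invariant-snoc-extension : ∀ {acc prev f g} → f ≢ [] → ¬ IsCopyOf prev (f ++ g) → Invariant acc prev f →
                             Invariant (acc ++ (f ++ g) ∷ []) (prev ++ f ∷ []) g
  Invariant-snoc-extension {acc} {prev} {f} {g} f≢[] ¬copy inv e with (f ++ g) ≟ₗ e
  ... | no fg≢e  = Status-snoc-≢ g fg≢e (inv e)
  ... | yes refl with inv (f ++ g)
  ...   | unseen fg∉acc = pending prev f refl f≢[] refl (≤-reflexive (count-snoc-∉ fg∉acc))
  ...   | copied copy _ = contradiction copy ¬copy
  ...   | pending _ _ prev≡ _ fg≡ c≤1 =
          copied (IsCopyOf-last₂ prev≡ fg≡) (≤-trans (≤-reflexive (count-snoc-≡ (f ++ g) acc)) (s≤s c≤1))

  CharStep-∉ : ∀ {acc prev f} → Invariant acc prev f → CharStep prev f → f ∉ acc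
  CharStep-∉ inv (c , refl , c∉prev) c∈acc with inv (c ∷ [])
  ... | unseen c∉acc             = c∉acc c∈acc
  ... | copied copy _            = c∉prev (IsCopyOf-⊆ copy (here refl))
  ... | pending _ _ _ h≢[] c≡hc _ = <⇒≢ (length-<-++ʳ (c ∷ []) h≢[]) (cong length c≡hc)

  extension-¬IsCopyOf : ∀ {acc prev f g rest} → Invariant acc prev f → f ∈ acc →
                        GreedyFrom prev (f ∷ g ∷ rest) → ¬ IsCopyOf prev (f ++ g)
  extension-¬IsCopyOf inv f∈acc greedy with greedy-char-or-¬copy greedy
  ... | inj₁ char  = contradiction f∈acc (CharStep-∉ inv char)
  ... | inj₂ ¬copy = ¬copy

  Invariant-step : ∀ {acc prev f g rest b} → Reflects (f ∈ acc) b → Invariant acc prev f →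
                   GreedyFrom prev (f ∷ g ∷ rest) →
                   Invariant (acc ++ (if b then f ++ g else f) ∷ []) (prev ++ f ∷ []) g
  Invariant-step (ofʸ f∈acc) inv greedy =
    Invariant-snoc-extension (proj₁ (proj₁ greedy)) (extension-¬IsCopyOf inv f∈acc greedy) inv
  Invariant-step {g = g} (ofⁿ f∉acc) inv _ = Invariant-snoc-fresh g f∉acc inv

  Invariant-last : ∀ {acc prev f b} → Reflects (f ∈ acc) b → Invariant acc prev f →
                   ∀ e → count e (acc ++ (if b then [] else f ∷ [])) ≤ 2
  Invariant-last {acc} (ofʸ _) inv e =
    subst (λ xs → count e xs ≤ 2) (sym (++-identityʳ acc)) (Status-count≤2 (inv e))
  Invariant-last {f = f} (ofⁿ f∉acc) inv e = Status-count≤2 (Invariant-snoc-fresh f f∉acc inv e)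

  extGo-count≤2 : ∀ {acc prev f} k fs → Invariant acc prev f → GreedyFrom prev (f ∷ fs) →
                  ∀ e → count e (acc ++ extGo _≟_ acc (f ∷ take k fs)) ≤ 2
  extGo-count≤2 {acc} {f = f} zero    fs       inv _ = Invariant-last (memb-reflects f acc) inv
  extGo-count≤2 {acc} {f = f} (suc k) []       inv _ = Invariant-last (memb-reflects f acc) inv
  extGo-count≤2 {acc} {f = f} (suc k) (g ∷ fs) inv greedy e =
    subst (λ xs → count e xs ≤ 2) (++-assoc acc (E ∷ []) (extGo _≟_ (acc ++ E ∷ []) (g ∷ take k fs)))
      (extGo-count≤2 k fs (Invariant-step (memb-reflects f acc) inv greedy) (proj₂ greedy) e)
    where E = if memb _≟_ f acc then f ++ g else f

  extendedFactors-count≤2 : ∀ {fs} → GreedyFrom [] fs → ∀ k e → count e (extendedFactors _≟_ (take k fs)) ≤ 2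
  extendedFactors-count≤2          _      zero    e = z≤n
  extendedFactors-count≤2 {[]}     _      (suc k) e = z≤n
  extendedFactors-count≤2 {_ ∷ fs} greedy (suc k) e =
    extGo-count≤2 {acc = []} k fs (λ _ → unseen λ ()) greedy e

mainTheorem5 : {A : Set} (_≟_ : DecidableEquality A) (T : List A) (fs : List (List A)) →
    IsGreedyLZSE T fs → (k : ℕ) → 1 ≤ k → k ≤ length fs →
    ∀ e → e ∈ extendedFactors _≟_ (take k fs) →
    countStr _≟_ e (extendedFactors _≟_ (take k fs)) ≤ 2
mainTheorem5 _≟_ _ _ (_ , greedy) k _ _ e _ = extendedFactors-count≤2 _≟_ greedy k e
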